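{- Let $n\geq1$ and $m\geq2$, and let $\sigma_0,\dots,\sigma_m$ be the Coxeter generators of $\tilde C_m$. Setting $\sigma_i(v)=s_i(v)$ for each vertex $v$ of $Y_{n,m}$ and extending multiplicatively gives a well-defined action of $\tilde C_m$ on the vertex set of $Y_{n,m}$, and $Y_{n,m}$ is the Schreier graph of $\tilde C_m$ with respect to the generating set $\{\sigma_0,\dots,\sigma_m\}$ and this action; that is, the action is transitive and two distinct vertices $u,v$ are adjacent in $Y_{n,m}$ iff $u=\sigma_i(v)$ for some $i$.
   Context: For integers $n\geq 1$, $m\geq 0$, the Yoke graph $Y_{n,m}$ has vertices the tuples $v=(v_0,\dots,v_{m+1})$ with $v_0,v_{m+1}\in\mathbb{Z}_n$, $v_1,\dots,v_m\in\{0,1\}$ and $\sum v_i\equiv0\pmod n$; $u,v$ are adjacent iff for some $0\leq i\leq m$, $u_j=v_j$ for $j\notin\{i,i+1\}$ and $(u_i,u_{i+1})=(v_i\pm1,v_{i+1}\mp1)$ (bucket coordinates $0,m+1$ in $\mathbb{Z}_n$, entries staying in their allowed sets). Maps $s_i$: $s_0(v)=(v_0+1,0,v_2,\dots,v_{m+1})$ if $v_1=1$ and $(v_0-1,1,v_2,\dots,v_{m+1})$ if $v_1=0$; $s_m(v)=(v_0,\dots,v_{m-1},1,v_{m+1}-1)$ if $v_m=0$ and $(v_0,\dots,v_{m-1},0,v_{m+1}+1)$ if $v_m=1$; for $1\leq i\leq m-1$, $s_i$ swaps $v_i,v_{i+1}$. $\tilde C_m$ is generated by $\sigma_0,\dots,\sigma_m$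 subject to $\sigma_i^2=1$, $(\sigma_i\sigma_j)^2=1$ ($|i-j|>1$), $(\sigma_i\sigma_{i+1})^3=1$ ($1\leq i\leq m-2$), $(\sigma_0\sigma_1)^4=(\sigma_{m-1}\sigma_m)^4=1$. -}

module Defs where

open import Data.Nat using (ℕ; zero; suc; _+_; _∸_; _≤_; _<_; _%_; _≡ᵇ_; NonZero)
open import Data.Nat.Divisibility using (_∣_)
open import Data.Bool using (Bool; true; false; if_then_else_; _∨_)
open import Data.Fin using (Fin; toℕ; inject₁; fromℕ)
import Data.Fin as F
open import Data.Vec using (Vec; lookup; _[_]≔_; sum)
open import Data.List using (List; []; _∷_)
open import Data.Product using (Σ; _×_; ∃)
open import Data.Sum using (_⊎_)
open import Relation.Binary.PropositionalEquality using (_≡_; _≢_)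
open import Relation.Nullary using (¬_)
open import Function.Bundles using (_⇔_)

-- Bucket coordinates 0 and m+1 represent elements of Z_n by their
-- representative in {0,...,n-1}; middle coordinates 1..m lie in {0,1}.
Tuple : ℕ → Set
Tuple m = Vec ℕ (suc (suc m))

first : (m : ℕ) → Fin (suc (suc m))
first m = F.zero

last : (m : ℕ) → Fin (suc (suc m))
last m = fromℕ (suc m)

record IsVertex (n m : ℕ) (v : Tuple m) : Set where
  field
    bucket₀   : lookup v (first m) < n
    bucketₘ₊₁ : lookup v (last m) < n
    middle    : (j : Fin m) → lookup v (F.suc (inject₁ j)) ≤ 1
    sumZero   : n ∣ sum v

module _ (n : ℕ) .{{_ : NonZero n}} where

  incₙ : ℕ → ℕ
  incₙ x = (x + 1) % n

  decₙ : ℕ → ℕ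
  decₙ x = (x + (n ∸ 1)) % n

  isBucket : (m : ℕ) → Fin (suc (suc m)) → Bool
  isBucket m j = (toℕ j ≡ᵇ 0) ∨ (toℕ j ≡ᵇ suc m)

  plus1At : (m : ℕ) → Fin (suc (suc m)) → ℕ → ℕ
  plus1At m j y = if isBucket m j then incₙ y else y + 1

  -- The maps s_0, ..., s_m (index i : Fin (m+1)).
  -- sAt m i b₀ bₘ v : b₀ = "i = 0", bₘ = "i = m".
  sAt : (m : ℕ) → Fin (suc m) → Bool → Bool → Tuple m → Tuple m
  sAt m i true _ v with lookup v (F.suc F.zero) ≡ᵇ 1
  ... | true  = (v [ F.zero ]≔ incₙ (lookup v F.zero)) [ F.suc F.zero ]≔ 0
  ... | false = (v [ F.zero ]≔ decₙ (lookup v F.zero)) [ F.suc F.zero ]≔ 1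
  sAt m i false true v with lookup v (inject₁ i) ≡ᵇ 0
  ... | true  = (v [ inject₁ i ]≔ 1) [ F.suc i ]≔ decₙ (lookup v (F.suc i))
  ... | false = (v [ inject₁ i ]≔ 0) [ F.suc i ]≔ incₙ (lookup v (F.suc i))
  sAt m i false false v =
    (v [ inject₁ i ]≔ lookup v (F.suc i)) [ F.suc i ]≔ lookup v (inject₁ i)

  s : (m : ℕ) → Fin (suc m) → Tuple m → Tuple m
  s m i v = sAt m i (toℕ i ≡ᵇ 0) (toℕ i ≡ᵇ m) v

  -- adjacency in Y_{n,m}: for some 0 ≤ i ≤ m, u and v agree off {i,i+1}
  -- and (u_i,u_{i+1}) = (v_i + 1, v_{i+1} - 1) or (v_i - 1, v_{i+1} + 1),
  -- where "x = y - 1" is written "y = x + 1".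
  Adjacent : (m : ℕ) → Tuple m → Tuple m → Set
  Adjacent m u v = Σ (Fin (suc m)) λ i →
    ((j : Fin (suc (suc m))) → j ≢ inject₁ i → j ≢ F.suc i → lookup u j ≡ lookup v j)
    × ( (lookup u (inject₁ i) ≡ plus1At m (inject₁ i) (lookup v (inject₁ i))
         × lookup v (F.suc i) ≡ plus1At m (F.suc i) (lookup u (F.suc i)))
      ⊎ (lookup v (inject₁ i) ≡ plus1At m (inject₁ i) (lookup u (inject₁ i))
         × lookup u (F.suc i) ≡ plus1At m (F.suc i) (lookup v (F.suc i))) )

  -- action of a word σ_{i_1} ⋯ σ_{i_k} (list [i_1,…,i_k]) : rightmost acts first
  act : (m : ℕ) → List (Fin (suc m)) → Tuple m → Tuple m
  act m []      v = v
  act m (i ∷ w) v = s m i (act m w v)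

  -- the s_i preserve the vertex set and satisfy the defining relations of C̃_m,
  -- so σ_i ↦ s_i extends to a well-defined action of C̃_m on V(Y_{n,m})
  record CoxeterAction (m : ℕ) : Set where
    field
      preserves : (i : Fin (suc m)) (v : Tuple m) → IsVertex n m v → IsVertex n m (s m i v)
      rel-sq    : (i : Fin (suc m)) (v : Tuple m) → IsVertex n m v →
                  act m (i ∷ i ∷ []) v ≡ v
      rel-far   : (i j : Fin (suc m)) → (suc (toℕ i) < toℕ j ⊎ suc (toℕ j) < toℕ i) → (v : Tuple m) → IsVertex n m v →
                  act m (i ∷ j ∷ i ∷ j ∷ []) v ≡ v
      rel-mid   : (i j : Fin (suc m)) → toℕ j ≡ suc (toℕ i) → 1 ≤ toℕ i → toℕ i ≤ m ∸ 2 →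
                  (v : Tuple m) → IsVertex n m v →
                  act m (i ∷ j ∷ i ∷ j ∷ i ∷ j ∷ []) v ≡ v
      rel-left  : (i j : Fin (suc m)) → toℕ i ≡ 0 → toℕ j ≡ 1 →
                  (v : Tuple m) → IsVertex n m v →
                  act m (i ∷ j ∷ i ∷ j ∷ i ∷ j ∷ i ∷ j ∷ []) v ≡ v
      rel-right : (i j : Fin (suc m)) → toℕ i ≡ m ∸ 1 → toℕ j ≡ m →
                  (v : Tuple m) → IsVertex n m v →
                  act m (i ∷ j ∷ i ∷ j ∷ i ∷ j ∷ i ∷ j ∷ []) v ≡ v

  TransitiveAction : (m : ℕ) → Set
  TransitiveAction m = (u v : Tuple m) → IsVertex n m u → IsVertex n m v →
    ∃ λ (w : List (Fin (suc m))) → act m w v ≡ u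

  SchreierAdjacency : (m : ℕ) → Set
  SchreierAdjacency m = (u v : Tuple m) → IsVertex n m u → IsVertex n m v → u ≢ v →
    Adjacent m u v ⇔ (∃ λ (i : Fin (suc m)) → u ≡ s m i v)

{-# OPTIONS --safe #-}
-- Each generator s_σ changes only the pair (v_σ, v_{σ+1}), through a `move` that depends on
-- whether σ is the left end (v₀ ∈ ℤ/n), an inner site (two bits) or the right end (v_{m+1} ∈ ℤ/n).
-- Moves are involutions that respect the coordinate ranges and the coordinate sum modulo n; this
-- gives the action and σᵢ² = 1.  Generators at sites at distance ≥ 2 touch disjoint coordinates and
-- commute, and an alternating word in σᵢ, σᵢ₊₁ touches only three consecutive coordinates, where one
-- checks directly that (σᵢσᵢ₊₁) has order 3 on two bits and order 4 on a bucket and two bits.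
-- For transitivity, moving the first nonzero coordinate after v₀ one step to the left lowers the
-- weight Σ j·vⱼ by one, so every vertex reaches 0, and words can be undone since every σᵢ is an
-- involution.  Finally, an edge at site σ moves one unit between v_σ and v_{σ+1}; on admissible
-- values this is exactly the move of s_σ, whenever that move is not the identity.
module Submission where

open import Defs
open import Function using (_∘_)
open import Function.Bundles using (mk⇔)
open import Data.Bool using (Bool; true; false; if_then_else_)
open import Data.Empty using (⊥-elim)
open import Data.Nat
  using (ℕ; zero; suc; _+_; _*_; _∸_; _%_; _/_; _<_; _≤_; _≡ᵇ_; NonZero; >-nonZero⁻¹; z≤n; s≤s; s≤s⁻¹)
open import Data.Nat.Properties
  using ( +-assoc; +-comm; +-identityʳ; +-suc; +-cancelʳ-≡; +-commutativeSemigroup; m∸n+n≡m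
        ; <⇒≤; <⇒≢; <-trans; n<1+n; m≤n⇒m≤1+n; ≤-refl; ≤-reflexive)
open import Algebra.Properties.CommutativeSemigroup +-commutativeSemigroup
  using (interchange; xy∙z≈xz∙y; x∙yz≈xz∙y; xy∙z≈zy∙x)
open import Data.Nat.DivMod using (m%n<n; m<n⇒m%n≡m; m%n%n≡m%n; %-distribˡ-+; [m+n]%n≡m%n; m≡m%n+[m/n]*n)
open import Data.Nat.Divisibility using (_∣_; ∣m+n∣m⇒∣n; ∣m∣n⇒∣m+n; n∣m*n; n∣m⇒m%n≡0)
open import Data.Nat.GeneralisedArithmetic using (fold)
open import Data.Nat.Induction using (<-wellFounded)
open import Data.Nat.Tactic.RingSolver using (solve-∀)
open import Data.Fin using (Fin; toℕ; inject₁)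
import Data.Fin as F
open import Data.Fin.Properties using (toℕ-inject₁; toℕ-fromℕ; toℕ-injective; toℕ<n; suc-injective)
import Data.Fin.Relation.Unary.Top as Top
open import Data.Vec using (Vec; []; _∷_; lookup; _[_]≔_; sum; replicate)
open import Data.Vec.Properties
  using ( []≔-idempotent; []≔-commutes; []≔-lookup; lookup∘update; lookup∘update′
        ; tabulate∘lookup; tabulate-cong; lookup-replicate)
open import Data.List using (List; []; _∷_; _++_; reverse)
open import Data.List.Properties using (unfold-reverse)
open import Data.Product using (_×_; _,_; proj₁; proj₂; ∃; ∃₂)
open import Data.Sum using (_⊎_; inj₁; inj₂; [_,_]′)
open import Induction.WellFounded using (Acc; acc)
open import Relation.Binary.PropositionalEquality
open import Relation.Nullary using (yes; no)

private variable
  k : ℕ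
  A : Set

-- Indices and vectors

≡ᵇ-refl : ∀ a → (a ≡ᵇ a) ≡ true
≡ᵇ-refl zero    = refl
≡ᵇ-refl (suc a) = ≡ᵇ-refl a

<⇒≡ᵇ-false : ∀ {a b} → a < b → (a ≡ᵇ b) ≡ false
<⇒≡ᵇ-false {zero}  (s≤s _)   = refl
<⇒≡ᵇ-false {suc a} (s≤s a<b) = <⇒≡ᵇ-false a<b

inject₁≢suc : (i : Fin k) → inject₁ i ≢ F.suc i
inject₁≢suc F.zero    ()
inject₁≢suc (F.suc i) eq = inject₁≢suc i (suc-injective eq)

lookup-extensionality : {xs ys : Vec A k} → (∀ j → lookup xs j ≡ lookup ys j) → xs ≡ ys
lookup-extensionality {xs = xs} {ys} eq =
  trans (sym (tabulate∘lookup xs)) (trans (tabulate-cong eq) (tabulate∘lookup ys))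

alternate : ℕ → A → A → List A
alternate zero    _ _ = []
alternate (suc k) a b = a ∷ b ∷ alternate k a b

set₂ : Fin k → Fin k → A × A → Vec A k → Vec A k
set₂ a b (x , y) v = (v [ a ]≔ x) [ b ]≔ y

set₃ : Fin k → Fin k → Fin k → A × A × A → Vec A k → Vec A k
set₃ a b c (x , y , z) v = ((v [ a ]≔ x) [ b ]≔ y) [ c ]≔ z

lookup-set₂-other : ∀ {a b j : Fin k} → j ≢ a → j ≢ b → ∀ (v : Vec A k) xy →
                    lookup (set₂ a b xy v) j ≡ lookup v j
lookup-set₂-other j≢a j≢b v (x , y) =
  trans (lookup∘update′ j≢b (v [ _ ]≔ x) y) (lookup∘update′ j≢a v x)

set₂-lookup : ∀ (a b : Fin k) (v : Vec A k) → set₂ a b (lookup v a , lookup v b) v ≡ v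
set₂-lookup a b v = trans (cong (_[ b ]≔ lookup v b) ([]≔-lookup v a)) ([]≔-lookup v b)

set₂-commutes : ∀ {a b c d : Fin k} → a ≢ c → a ≢ d → b ≢ c → b ≢ d → ∀ (v : Vec A k) xy zw →
                set₂ a b xy (set₂ c d zw v) ≡ set₂ c d zw (set₂ a b xy v)
set₂-commutes {a = a} {b} {c} {d} a≢c a≢d b≢c b≢d v (x , y) (z , w) = begin
  (((v [ c ]≔ z) [ d ]≔ w) [ a ]≔ x) [ b ]≔ y
    ≡⟨ cong (_[ b ]≔ y) ([]≔-commutes _ d a (a≢d ∘ sym)) ⟩
  (((v [ c ]≔ z) [ a ]≔ x) [ d ]≔ w) [ b ]≔ y
    ≡⟨ []≔-commutes _ d b (b≢d ∘ sym) ⟩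
  (((v [ c ]≔ z) [ a ]≔ x) [ b ]≔ y) [ d ]≔ w
    ≡⟨ cong (λ u → (u [ b ]≔ y) [ d ]≔ w) ([]≔-commutes v c a (a≢c ∘ sym)) ⟩
  (((v [ a ]≔ x) [ c ]≔ z) [ b ]≔ y) [ d ]≔ w
    ≡⟨ cong (_[ d ]≔ w) ([]≔-commutes _ c b (b≢c ∘ sym)) ⟩
  (((v [ a ]≔ x) [ b ]≔ y) [ c ]≔ z) [ d ]≔ w
    ∎
  where open ≡-Reasoning

module _ {a b : Fin k} (a≢b : a ≢ b) where

  lookup-set₂ˡ : ∀ (v : Vec A k) x y → lookup (set₂ a b (x , y) v) a ≡ x
  lookup-set₂ˡ v x y = trans (lookup∘update′ a≢b (v [ a ]≔ x) y) (lookup∘update a v x)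

  lookup-set₂ʳ : ∀ (v : Vec A k) x y → lookup (set₂ a b (x , y) v) b ≡ y
  lookup-set₂ʳ v x y = lookup∘update b (v [ a ]≔ x) y

  set₂-idempotent : ∀ (v : Vec A k) xy x′y′ → set₂ a b xy (set₂ a b x′y′ v) ≡ set₂ a b xy v
  set₂-idempotent v (x , y) (x′ , y′) = begin
    (((v [ a ]≔ x′) [ b ]≔ y′) [ a ]≔ x) [ b ]≔ y
      ≡⟨ cong (_[ b ]≔ y) ([]≔-commutes (v [ a ]≔ x′) b a (a≢b ∘ sym)) ⟩
    (((v [ a ]≔ x′) [ a ]≔ x) [ b ]≔ y′) [ b ]≔ y
      ≡⟨ []≔-idempotent _ b ⟩
    ((v [ a ]≔ x′) [ a ]≔ x) [ b ]≔ y
      ≡⟨ cong (_[ b ]≔ y) ([]≔-idempotent v a) ⟩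
    (v [ a ]≔ x) [ b ]≔ y
      ∎
    where open ≡-Reasoning

  agree-off⇒≡set₂ : ∀ {u v : Vec A k} → (∀ j → j ≢ a → j ≢ b → lookup u j ≡ lookup v j) →
                    u ≡ set₂ a b (lookup u a , lookup u b) v
  agree-off⇒≡set₂ {u = u} {v} agree = lookup-extensionality pointwise
    where
    pointwise : ∀ j → lookup u j ≡ lookup (set₂ a b (lookup u a , lookup u b) v) j
    pointwise j with j F.≟ a | j F.≟ b
    ... | yes refl | _        = sym (lookup-set₂ˡ v _ _)
    ... | no _     | yes refl = sym (lookup-set₂ʳ v _ _)
    ... | no j≢a   | no j≢b   = trans (agree j j≢a j≢b) (sym (lookup-set₂-other j≢a j≢b v _))

module _ {a b c : Fin k} (a≢b : a ≢ b) (a≢c : a ≢ c) (b≢c : b ≢ c) where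

  set₃-lookup : ∀ (v : Vec A k) → set₃ a b c (lookup v a , lookup v b , lookup v c) v ≡ v
  set₃-lookup v = trans (cong (_[ c ]≔ lookup v c) (set₂-lookup a b v)) ([]≔-lookup v c)

  private
    lookup-set₃-b : ∀ (v : Vec A k) x y z → lookup (set₃ a b c (x , y , z) v) b ≡ y
    lookup-set₃-b v x y z = trans (lookup∘update′ b≢c (set₂ a b (x , y) v) z) (lookup-set₂ʳ a≢b v x y)

  lookup-set₃ˡ : ∀ (v : Vec A k) x y z →
                 (lookup (set₃ a b c (x , y , z) v) a , lookup (set₃ a b c (x , y , z) v) b) ≡ (x , y)
  lookup-set₃ˡ v x y z =
    cong₂ _,_ (trans (lookup∘update′ a≢c (set₂ a b (x , y) v) z) (lookup-set₂ˡ a≢b v x y))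
              (lookup-set₃-b v x y z)

  lookup-set₃ʳ : ∀ (v : Vec A k) x y z →
                 (lookup (set₃ a b c (x , y , z) v) b , lookup (set₃ a b c (x , y , z) v) c) ≡ (y , z)
  lookup-set₃ʳ v x y z = cong₂ _,_ (lookup-set₃-b v x y z) (lookup∘update c (set₂ a b (x , y) v) z)

  set₂-set₃ˡ : ∀ (v : Vec A k) x y z x′ y′ →
               set₂ a b (x′ , y′) (set₃ a b c (x , y , z) v) ≡ set₃ a b c (x′ , y′ , z) v
  set₂-set₃ˡ v x y z x′ y′ = begin
    ((w [ c ]≔ z) [ a ]≔ x′) [ b ]≔ y′  ≡⟨ cong (_[ b ]≔ y′) ([]≔-commutes w c a (a≢c ∘ sym)) ⟩
    ((w [ a ]≔ x′) [ c ]≔ z) [ b ]≔ y′  ≡⟨ []≔-commutes _ c b (b≢c ∘ sym) ⟩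
    set₂ a b (x′ , y′) w [ c ]≔ z       ≡⟨ cong (_[ c ]≔ z) (set₂-idempotent a≢b v (x′ , y′) (x , y)) ⟩
    set₃ a b c (x′ , y′ , z) v          ∎
    where open ≡-Reasoning
          w = set₂ a b (x , y) v

  set₂-set₃ʳ : ∀ (v : Vec A k) x y z y′ z′ →
               set₂ b c (y′ , z′) (set₃ a b c (x , y , z) v) ≡ set₃ a b c (x , y′ , z′) v
  set₂-set₃ʳ v x y z y′ z′ = set₂-idempotent b≢c (v [ a ]≔ x) (y′ , z′) (y , z)

-- weight v = Σⱼ j · vⱼ
weight : Vec ℕ k → ℕ
weight []       = 0
weight (x ∷ xs) = sum xs + weight xs

sum-replicate-zero : ∀ k → sum (replicate k 0) ≡ 0
sum-replicate-zero zero    = refl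
sum-replicate-zero (suc k) = sum-replicate-zero k

sum-[]≔ : ∀ (xs : Vec ℕ k) i x → sum (xs [ i ]≔ x) + lookup xs i ≡ sum xs + x
sum-[]≔ (y ∷ ys) F.zero    x = xy∙z≈zy∙x x (sum ys) y
sum-[]≔ (y ∷ ys) (F.suc i) x =
  trans (+-assoc y _ _) (trans (cong (y +_) (sum-[]≔ ys i x)) (sym (+-assoc y _ _)))

weight-[]≔ : ∀ (xs : Vec ℕ k) i x → weight (xs [ i ]≔ x) + toℕ i * lookup xs i ≡ weight xs + toℕ i * x
weight-[]≔ (y ∷ ys) F.zero    x = refl
weight-[]≔ (y ∷ ys) (F.suc i) x = begin
  sum ys′ + weight ys′ + (l + toℕ i * l)    ≡⟨ interchange (sum ys′) (weight ys′) l (toℕ i * l) ⟩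
  (sum ys′ + l) + (weight ys′ + toℕ i * l)  ≡⟨ cong₂ _+_ (sum-[]≔ ys i x) (weight-[]≔ ys i x) ⟩
  (sum ys + x) + (weight ys + toℕ i * x)    ≡⟨ interchange (sum ys) (weight ys) x (toℕ i * x) ⟨
  sum ys + weight ys + (x + toℕ i * x)      ∎
  where open ≡-Reasoning
        ys′ = ys [ i ]≔ x
        l = lookup ys i

private
  exchange : ∀ f₀ f₁ f₂ {α β x y : ℕ} → f₂ + β ≡ f₁ + y → f₁ + α ≡ f₀ + x → f₂ + (α + β) ≡ f₀ + (x + y)
  exchange f₀ f₁ f₂ {α} {β} {x} {y} e₂ e₁ = begin
    f₂ + (α + β)  ≡⟨ x∙yz≈xz∙y f₂ α β ⟩
    f₂ + β + α    ≡⟨ cong (_+ α) e₂ ⟩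
    f₁ + y + α    ≡⟨ xy∙z≈xz∙y f₁ y α ⟩
    f₁ + α + y    ≡⟨ cong (_+ y) e₁ ⟩
    f₀ + x + y    ≡⟨ +-assoc f₀ x y ⟩
    f₀ + (x + y)  ∎
    where open ≡-Reasoning

module _ {a b : Fin k} (a≢b : a ≢ b) (v : Vec ℕ k) (x y : ℕ) where

  private
    lookup-b : lookup (v [ a ]≔ x) b ≡ lookup v b
    lookup-b = lookup∘update′ (a≢b ∘ sym) v x

  sum-set₂ : sum (set₂ a b (x , y) v) + (lookup v a + lookup v b) ≡ sum v + (x + y)
  sum-set₂ = exchange (sum v) (sum (v [ a ]≔ x)) (sum (set₂ a b (x , y) v))
    (trans (cong (sum (set₂ a b (x , y) v) +_) (sym lookup-b)) (sum-[]≔ (v [ a ]≔ x) b y))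
    (sum-[]≔ v a x)

  weight-set₂ : weight (set₂ a b (x , y) v) + (toℕ a * lookup v a + toℕ b * lookup v b)
              ≡ weight v + (toℕ a * x + toℕ b * y)
  weight-set₂ = exchange (weight v) (weight (v [ a ]≔ x)) (weight (set₂ a b (x , y) v))
    (trans (cong (λ l → weight (set₂ a b (x , y) v) + toℕ b * l) (sym lookup-b)) (weight-[]≔ (v [ a ]≔ x) b y))
    (weight-[]≔ v a x)

vanishes⊎rises : ∀ (xs : Vec ℕ (suc k)) →
  (∀ j → lookup xs j ≡ 0) ⊎ 1 ≤ lookup xs F.zero ⊎
  ∃ λ (j : Fin k) → lookup xs (inject₁ j) ≡ 0 × 1 ≤ lookup xs (F.suc j)
vanishes⊎rises (suc x ∷ xs)    = inj₂ (inj₁ (s≤s z≤n))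
vanishes⊎rises (zero ∷ [])     = inj₁ λ { F.zero → refl }
vanishes⊎rises (zero ∷ y ∷ ys) with vanishes⊎rises (y ∷ ys)
... | inj₁ zeros             = inj₁ λ { F.zero → refl ; (F.suc j) → zeros j }
... | inj₂ (inj₁ 1≤y)        = inj₂ (inj₂ (F.zero , refl , 1≤y))
... | inj₂ (inj₂ (j , rise)) = inj₂ (inj₂ (F.suc j , rise))

-- Arithmetic modulo n

module _ {n : ℕ} .{{_ : NonZero n}} where

  private
    %-absorbˡ : ∀ a b → (a % n + b) % n ≡ (a + b) % n
    %-absorbˡ a b = begin
      (a % n + b) % n          ≡⟨ %-distribˡ-+ (a % n) b n ⟩
      (a % n % n + b % n) % n  ≡⟨ cong (λ r → (r + b % n) % n) (m%n%n≡m%n a n) ⟩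
      (a % n + b % n) % n      ≡⟨ %-distribˡ-+ a b n ⟨
      (a + b) % n              ∎
      where open ≡-Reasoning

    +[n∸1]+1≡+n : ∀ x → x + (n ∸ 1) + 1 ≡ x + n
    +[n∸1]+1≡+n x = trans (+-assoc x (n ∸ 1) 1) (cong (x +_) (m∸n+n≡m (>-nonZero⁻¹ n)))

    +n%n : ∀ {x y} → y ≡ x + n → x < n → y % n ≡ x
    +n%n {x} refl x<n = trans ([m+n]%n≡m%n x n) (m<n⇒m%n≡m x<n)

  incₙ<n : ∀ x → incₙ n x < n
  incₙ<n x = m%n<n (x + 1) n

  decₙ<n : ∀ x → decₙ n x < n
  decₙ<n x = m%n<n (x + (n ∸ 1)) n

  decₙ∘incₙ : ∀ {x} → x < n → decₙ n (incₙ n x) ≡ x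
  decₙ∘incₙ {x} x<n =
    trans (%-absorbˡ (x + 1) (n ∸ 1)) (+n%n (trans (xy∙z≈xz∙y x 1 (n ∸ 1)) (+[n∸1]+1≡+n x)) x<n)

  incₙ∘decₙ : ∀ {x} → x < n → incₙ n (decₙ n x) ≡ x
  incₙ∘decₙ {x} x<n = trans (%-absorbˡ (x + (n ∸ 1)) 1) (+n%n (+[n∸1]+1≡+n x) x<n)

  decₙ-suc : ∀ {c} → suc c < n → decₙ n (suc c) ≡ c
  decₙ-suc {c} 1+c<n = +n%n (trans (+-comm 1 (c + (n ∸ 1))) (+[n∸1]+1≡+n c)) (<⇒≤ 1+c<n)

  infix 4 _≡ₙ_
  _≡ₙ_ : ℕ → ℕ → Set
  X ≡ₙ Y = ∃₂ λ a b → X + a * n ≡ Y + b * n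

  +1≡ₙincₙ : ∀ x → x + 1 ≡ₙ incₙ n x
  +1≡ₙincₙ x = 0 , (x + 1) / n , trans (+-identityʳ (x + 1)) (m≡m%n+[m/n]*n (x + 1) n)

  ≡ₙdecₙ+1 : ∀ x → x ≡ₙ decₙ n x + 1
  ≡ₙdecₙ+1 x = 1 , q , (begin
    x + 1 * n               ≡⟨ cong (x +_) (+-identityʳ n) ⟩
    x + n                   ≡⟨ +[n∸1]+1≡+n x ⟨
    x + (n ∸ 1) + 1         ≡⟨ cong (_+ 1) (m≡m%n+[m/n]*n (x + (n ∸ 1)) n) ⟩
    decₙ n x + q * n + 1    ≡⟨ xy∙z≈xz∙y (decₙ n x) (q * n) 1 ⟩
    decₙ n x + 1 + q * n    ∎)
    where open ≡-Reasoning
          q = (x + (n ∸ 1)) / n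

  ∣-transfer : ∀ {S T X Y} → n ∣ S → T + X ≡ S + Y → X ≡ₙ Y → n ∣ T
  ∣-transfer {S} {T} {X} {Y} n∣S T+X≡S+Y (a , b , X+an≡Y+bn) =
    ∣m+n∣m⇒∣n (subst (n ∣_) (trans (sym T+bn≡S+an) (+-comm T (b * n))) (∣m∣n⇒∣m+n n∣S (n∣m*n a))) (n∣m*n b)
    where
    T+bn≡S+an : T + b * n ≡ S + a * n
    T+bn≡S+an = +-cancelʳ-≡ Y _ _ (begin
      T + b * n + Y    ≡⟨ xy∙z≈xz∙y T (b * n) Y ⟩
      T + Y + b * n    ≡⟨ +-assoc T Y (b * n) ⟩
      T + (Y + b * n)  ≡⟨ cong (T +_) X+an≡Y+bn ⟨
      T + (X + a * n)  ≡⟨ +-assoc T X (a * n) ⟨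
      T + X + a * n    ≡⟨ cong (_+ a * n) T+X≡S+Y ⟩
      S + Y + a * n    ≡⟨ xy∙z≈xz∙y S Y (a * n) ⟩
      S + a * n + Y    ∎)
      where open ≡-Reasoning

-- Moves at a site

-- A site σ is the pair of coordinates (σ, σ+1).  `ends` records which of the two are buckets
-- (valued in ℤ/n rather than in {0, 1}); `siteFor` reads the site off the two flags of `sAt`.
data Site : Set where
  left inner right : Site

siteFor : Bool → Bool → Site
siteFor true  _     = left
siteFor false true  = right
siteFor false false = inner

ends : Site → Bool × Bool
ends left  = true , false
ends inner = false , false
ends right = false , true

-- The contribution of coordinates p and p+1 to `weight`.
moment : ℕ → ℕ × ℕ → ℕ
moment p (x , y) = p * x + suc p * y

module _ (n : ℕ) .{{_ : NonZero n}} where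

  move : Site → ℕ × ℕ → ℕ × ℕ
  move left  (x , y) = if y ≡ᵇ 1 then (incₙ n x , 0) else (decₙ n x , 1)
  move inner (x , y) = y , x
  move right (x , y) = if x ≡ᵇ 0 then (1 , decₙ n y) else (0 , incₙ n y)

  moveˡ moveʳ : Site → ℕ × ℕ × ℕ → ℕ × ℕ × ℕ
  moveˡ κ (x , y , z) = proj₁ (move κ (x , y)) , proj₂ (move κ (x , y)) , z
  moveʳ κ (x , yz)    = x , move κ yz

  bucketCap : Bool → ℕ
  bucketCap b = if b then n else 2

  bucketBump : Bool → ℕ → ℕ
  bucketBump b y = if b then incₙ n y else y + 1

  Admissible : Bool × Bool → ℕ × ℕ → Set
  Admissible (b , c) (x , y) = x < bucketCap b × y < bucketCap c

  -- The pair component of `Adjacent`: one unit moves between the two coordinates.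
  Step : Bool × Bool → ℕ × ℕ → ℕ × ℕ → Set
  Step (b , c) (x , y) (x′ , y′) =
    (x′ ≡ bucketBump b x × y ≡ bucketBump c y′) ⊎ (x ≡ bucketBump b x′ × y′ ≡ bucketBump c y)

module _ {n : ℕ} .{{_ : NonZero n}} where

  move-admissible : ∀ κ {xy} → Admissible n (ends κ) xy → Admissible n (ends κ) (move n κ xy)
  move-admissible left  (_ , s≤s z≤n)         = decₙ<n _ , s≤s (s≤s z≤n)
  move-admissible left  (_ , s≤s (s≤s z≤n))   = incₙ<n _ , s≤s z≤n
  move-admissible inner (x<2 , y<2)           = y<2 , x<2
  move-admissible right (s≤s z≤n , _)         = s≤s (s≤s z≤n) , decₙ<n _
  move-admissible right (s≤s (s≤s z≤n) , _)   = s≤s z≤n , incₙ<n _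

  move-involutive : ∀ κ {xy} → Admissible n (ends κ) xy → move n κ (move n κ xy) ≡ xy
  move-involutive left  (x<n , s≤s z≤n)       = cong (_, 0) (incₙ∘decₙ x<n)
  move-involutive left  (x<n , s≤s (s≤s z≤n)) = cong (_, 1) (decₙ∘incₙ x<n)
  move-involutive inner _                     = refl
  move-involutive right (s≤s z≤n , y<n)       = cong (0 ,_) (incₙ∘decₙ y<n)
  move-involutive right (s≤s (s≤s z≤n) , y<n) = cong (1 ,_) (decₙ∘incₙ y<n)

  move-congruent : ∀ κ {x y} → Admissible n (ends κ) (x , y) →
                   x + y ≡ₙ proj₁ (move n κ (x , y)) + proj₂ (move n κ (x , y))
  move-congruent left  {x}     (_ , s≤s z≤n)       = subst (_≡ₙ decₙ n x + 1) (sym (+-identityʳ x)) (≡ₙdecₙ+1 x)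
  move-congruent left  {x}     (_ , s≤s (s≤s z≤n)) = subst (x + 1 ≡ₙ_) (sym (+-identityʳ _)) (+1≡ₙincₙ x)
  move-congruent inner {x} {y} _                   = 0 , 0 , cong (_+ 0) (+-comm x y)
  move-congruent right {y = y} (s≤s z≤n , _)       = subst (y ≡ₙ_) (+-comm (decₙ n y) 1) (≡ₙdecₙ+1 y)
  move-congruent right {y = y} (s≤s (s≤s z≤n) , _) = subst (_≡ₙ incₙ n y) (+-comm y 1) (+1≡ₙincₙ y)

  private
    unit-step : ∀ {y y′} → y < 2 → y ≡ y′ + 1 → y ≡ 1 × y′ ≡ 0
    unit-step {y′ = y′} y<2 y≡ = unit y<2 (trans y≡ (+-comm y′ 1))
      where unit : ∀ {y y′} → y < 2 → y ≡ suc y′ → y ≡ 1 × y′ ≡ 0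
            unit (s≤s (s≤s z≤n)) refl = refl , refl

  step⇒move : ∀ κ {xy x′y′} → Admissible n (ends κ) xy → Admissible n (ends κ) x′y′ →
              Step n (ends κ) xy x′y′ → x′y′ ≡ move n κ xy
  step⇒move left (_ , y<2) _ (inj₁ (x′≡ , y≡)) with unit-step y<2 y≡
  ... | refl , refl = cong (_, 0) x′≡
  step⇒move left _ (x′<n , y′<2) (inj₂ (x≡ , y′≡)) with unit-step y′<2 y′≡
  ... | refl , refl = cong (_, 1) (sym (trans (cong (decₙ n) x≡) (decₙ∘incₙ x′<n)))
  step⇒move inner (_ , y<2) (x′<2 , _) (inj₁ (x′≡ , y≡)) with unit-step x′<2 x′≡ | unit-step y<2 y≡
  ... | refl , refl | refl , refl = refl
  step⇒move inner (x<2 , _) (_ , y′<2) (inj₂ (x≡ , y′≡)) with unit-step x<2 x≡ | unit-step y′<2 y′≡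
  ... | refl , refl | refl , refl = refl
  step⇒move right _ (x′<2 , y′<n) (inj₁ (x′≡ , y≡)) with unit-step x′<2 x′≡
  ... | refl , refl = cong (1 ,_) (sym (trans (cong (decₙ n) y≡) (decₙ∘incₙ y′<n)))
  step⇒move right (x<2 , _) _ (inj₂ (x≡ , y′≡)) with unit-step x<2 x≡
  ... | refl , refl = cong (0 ,_) y′≡

  move⇒step : ∀ κ {xy} → Admissible n (ends κ) xy → move n κ xy ≢ xy → Step n (ends κ) xy (move n κ xy)
  move⇒step left  (x<n , s≤s z≤n)                 _     = inj₂ (sym (incₙ∘decₙ x<n) , refl)
  move⇒step left  (_ , s≤s (s≤s z≤n))             _     = inj₁ (refl , refl)
  move⇒step inner (s≤s z≤n , s≤s z≤n)             fixed = ⊥-elim (fixed refl)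
  move⇒step inner (s≤s z≤n , s≤s (s≤s z≤n))       _     = inj₁ (refl , refl)
  move⇒step inner (s≤s (s≤s z≤n) , s≤s z≤n)       _     = inj₂ (refl , refl)
  move⇒step inner (s≤s (s≤s z≤n) , s≤s (s≤s z≤n)) fixed = ⊥-elim (fixed refl)
  move⇒step right (s≤s z≤n , y<n)                 _     = inj₁ (refl , sym (incₙ∘decₙ y<n))
  move⇒step right (s≤s (s≤s z≤n) , _)             _     = inj₂ (refl , refl)

  move-left-lowers-moment : ∀ {x y} → y < 2 → 1 ≤ y → moment 0 (x , y) ≡ suc (moment 0 (move n left (x , y)))
  move-left-lowers-moment (s≤s (s≤s z≤n)) _ = refl

  move-lowers-moment : ∀ κ {y} → κ ≢ left → Admissible n (ends κ) (0 , y) → 1 ≤ y →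
                       ∀ p → moment p (0 , y) ≡ suc (moment p (move n κ (0 , y)))
  move-lowers-moment left  not-left _ _ _ = ⊥-elim (not-left refl)
  move-lowers-moment inner _ (_ , s≤s (s≤s z≤n)) _ p = unit-moves-left p
    where unit-moves-left : ∀ p → p * 0 + suc p * 1 ≡ suc (p * 1 + suc p * 0)
          unit-moves-left = solve-∀
  move-lowers-moment right {suc c} _ (_ , 1+c<n) _ p =
    trans (unit-moves-left p c) (cong (λ y → suc (p * 1 + suc p * y)) (sym (decₙ-suc 1+c<n)))
    where unit-moves-left : ∀ p c → p * 0 + suc p * suc c ≡ suc (p * 1 + suc p * c)
          unit-moves-left = solve-∀

  round-inner-inner³ : ∀ x y z → fold (x , y , z) (moveˡ n inner ∘ moveʳ n inner) 3 ≡ (x , y , z)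
  round-inner-inner³ x y z = refl

  private
    inc = incₙ n
    dec = decₙ n

    inc∘inc∘dec∘dec : ∀ {x} → x < n → inc (inc (dec (dec x))) ≡ x
    inc∘inc∘dec∘dec x<n = trans (cong inc (incₙ∘decₙ (decₙ<n _))) (incₙ∘decₙ x<n)

    inc∘dec∘dec∘inc : ∀ {x} → x < n → inc (dec (dec (inc x))) ≡ x
    inc∘dec∘dec∘inc x<n = trans (cong (inc ∘ dec) (decₙ∘incₙ x<n)) (incₙ∘decₙ x<n)

    dec∘inc∘inc∘dec : ∀ {x} → x < n → dec (inc (inc (dec x))) ≡ x
    dec∘inc∘inc∘dec x<n = trans (decₙ∘incₙ (incₙ<n _)) (incₙ∘decₙ x<n)

    dec∘dec∘inc∘inc : ∀ {x} → x < n → dec (dec (inc (inc x))) ≡ x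
    dec∘dec∘inc∘inc x<n = trans (cong dec (decₙ∘incₙ (incₙ<n _))) (decₙ∘incₙ x<n)

  round-left-inner⁴ : ∀ {x y z} → x < n → y < 2 → z < 2 →
                      fold (x , y , z) (moveˡ n left ∘ moveʳ n inner) 4 ≡ (x , y , z)
  round-left-inner⁴ x<n (s≤s z≤n)       (s≤s z≤n)       = cong (_, 0 , 0) (inc∘inc∘dec∘dec x<n)
  round-left-inner⁴ x<n (s≤s z≤n)       (s≤s (s≤s z≤n)) = cong (_, 0 , 1) (inc∘dec∘dec∘inc x<n)
  round-left-inner⁴ x<n (s≤s (s≤s z≤n)) (s≤s z≤n)       = cong (_, 1 , 0) (dec∘inc∘inc∘dec x<n)
  round-left-inner⁴ x<n (s≤s (s≤s z≤n)) (s≤s (s≤s z≤n)) = cong (_, 1 , 1) (dec∘dec∘inc∘inc x<n)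

  round-inner-right⁴ : ∀ {x y z} → x < 2 → y < 2 → z < n →
                       fold (x , y , z) (moveˡ n inner ∘ moveʳ n right) 4 ≡ (x , y , z)
  round-inner-right⁴ (s≤s z≤n)       (s≤s z≤n)       z<n = cong (λ z → 0 , 0 , z) (inc∘inc∘dec∘dec z<n)
  round-inner-right⁴ (s≤s z≤n)       (s≤s (s≤s z≤n)) z<n = cong (λ z → 0 , 1 , z) (inc∘dec∘dec∘inc z<n)
  round-inner-right⁴ (s≤s (s≤s z≤n)) (s≤s z≤n)       z<n = cong (λ z → 1 , 0 , z) (dec∘inc∘inc∘dec z<n)
  round-inner-right⁴ (s≤s (s≤s z≤n)) (s≤s (s≤s z≤n)) z<n = cong (λ z → 1 , 1 , z) (dec∘dec∘inc∘inc z<n)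

-- The Yoke graph

module Yoke (n m′ : ℕ) .{{_ : NonZero n}} where

  m : ℕ
  m = suc (suc m′)

  siteOf : Fin (suc m) → Site
  siteOf σ = siteFor (toℕ σ ≡ᵇ 0) (toℕ σ ≡ᵇ m)

  pairAt : Fin (suc m) → Tuple m → ℕ × ℕ
  pairAt σ v = lookup v (inject₁ σ) , lookup v (F.suc σ)

  setSite : Fin (suc m) → ℕ × ℕ → Tuple m → Tuple m
  setSite σ = set₂ (inject₁ σ) (F.suc σ)

  private
    sAt-local : ∀ σ b₀ bₘ v → (toℕ σ ≡ᵇ 0) ≡ b₀ →
                sAt n m σ b₀ bₘ v ≡ setSite σ (move n (siteFor b₀ bₘ) (pairAt σ v)) v
    sAt-local F.zero true _ v _ with lookup v (F.suc F.zero) ≡ᵇ 1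
    ... | true  = refl
    ... | false = refl
    sAt-local σ false true v _ with lookup v (inject₁ σ) ≡ᵇ 0
    ... | true  = refl
    ... | false = refl
    sAt-local σ false false v _ = refl

  s-local : ∀ σ v → s n m σ v ≡ setSite σ (move n (siteOf σ) (pairAt σ v)) v
  s-local σ v = sAt-local σ _ _ v refl

  pairAt-setSite : ∀ σ v xy → pairAt σ (setSite σ xy v) ≡ xy
  pairAt-setSite σ v (x , y) =
    cong₂ _,_ (lookup-set₂ˡ (inject₁≢suc σ) v x y) (lookup-set₂ʳ (inject₁≢suc σ) v x y)

  bucketFlags : Fin (suc m) → Bool × Bool
  bucketFlags σ = isBucket n m (inject₁ σ) , isBucket n m (F.suc σ)

  isBucket-middle : (j : Fin m) → isBucket n m (F.suc (inject₁ j)) ≡ false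
  isBucket-middle j = trans (cong (_≡ᵇ m) (toℕ-inject₁ j)) (<⇒≡ᵇ-false (toℕ<n j))

  isBucket-last : isBucket n m (last m) ≡ true
  isBucket-last = trans (cong (_≡ᵇ m) (toℕ-fromℕ m)) (≡ᵇ-refl m)

  bucketFlags-siteOf : ∀ σ → bucketFlags σ ≡ ends (siteOf σ)
  bucketFlags-siteOf F.zero = refl
  bucketFlags-siteOf (F.suc σ) rewrite isBucket-middle σ with toℕ σ ≡ᵇ suc m′
  ... | true  = refl
  ... | false = refl

  siteOf-inner : ∀ {σ} → 1 ≤ toℕ σ → toℕ σ < m → siteOf σ ≡ inner
  siteOf-inner {F.suc σ} _ (s≤s σ<m) = cong (siteFor false) (<⇒≡ᵇ-false σ<m)

  siteOf-last : ∀ {τ} → toℕ τ ≡ m → siteOf τ ≡ right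
  siteOf-last τ≡m = trans (cong (λ p → siteFor (p ≡ᵇ 0) (p ≡ᵇ m)) τ≡m) (cong (siteFor false) (≡ᵇ-refl m′))

  -- `IsVertex` with the bucket and bit constraints merged into one bound per coordinate.
  record Vertex (v : Tuple m) : Set where
    field
      bounded  : ∀ j → lookup v j < bucketCap n (isBucket n m j)
      balanced : n ∣ sum v

  open Vertex

  isVertex⇒vertex : ∀ {v} → IsVertex n m v → Vertex v
  isVertex⇒vertex {v} iv = record { bounded = bounded′ ; balanced = IsVertex.sumZero iv }
    where
    bounded′ : ∀ j → lookup v j < bucketCap n (isBucket n m j)
    bounded′ F.zero = IsVertex.bucket₀ iv
    bounded′ (F.suc j) with Top.view j
    ... | Top.‵fromℕ     = subst (λ b → lookup v (last m) < bucketCap n b) (sym isBucket-last)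
                                 (IsVertex.bucketₘ₊₁ iv)
    ... | Top.‵inject₁ i = subst (λ b → lookup v (F.suc (inject₁ i)) < bucketCap n b) (sym (isBucket-middle i))
                                 (s≤s (IsVertex.middle iv i))

  vertex⇒isVertex : ∀ {v} → Vertex v → IsVertex n m v
  vertex⇒isVertex {v} vv = record
    { bucket₀   = bounded vv F.zero
    ; bucketₘ₊₁ = subst (λ b → lookup v (last m) < bucketCap n b) isBucket-last (bounded vv (last m))
    ; middle    = λ j → s≤s⁻¹ (subst (λ b → lookup v (F.suc (inject₁ j)) < bucketCap n b) (isBucket-middle j)
                                     (bounded vv (F.suc (inject₁ j))))
    ; sumZero   = balanced vv
    }

  vertex⇒admissible : ∀ {v} → Vertex v → ∀ σ → Admissible n (ends (siteOf σ)) (pairAt σ v)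
  vertex⇒admissible {v} vv σ = subst (λ f → Admissible n f (pairAt σ v)) (bucketFlags-siteOf σ)
                                     (bounded vv (inject₁ σ) , bounded vv (F.suc σ))

  setSite-preserves : ∀ {v} σ {x y} → Vertex v → Admissible n (ends (siteOf σ)) (x , y) →
                      lookup v (inject₁ σ) + lookup v (F.suc σ) ≡ₙ x + y → Vertex (setSite σ (x , y) v)
  setSite-preserves {v} σ {x} {y} vv adm congruent = record { bounded = bounded′ ; balanced = balanced′ }
    where
    caps : Admissible n (bucketFlags σ) (x , y)
    caps = subst (λ f → Admissible n f (x , y)) (sym (bucketFlags-siteOf σ)) adm
    bounded′ : ∀ j → lookup (setSite σ (x , y) v) j < bucketCap n (isBucket n m j)
    bounded′ j with j F.≟ inject₁ σ | j F.≟ F.suc σ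
    ... | yes refl | _        = subst (_< _) (sym (lookup-set₂ˡ (inject₁≢suc σ) v x y)) (proj₁ caps)
    ... | no _     | yes refl = subst (_< _) (sym (lookup-set₂ʳ (inject₁≢suc σ) v x y)) (proj₂ caps)
    ... | no j≢a   | no j≢b   = subst (_< _) (sym (lookup-set₂-other j≢a j≢b v (x , y))) (bounded vv j)
    balanced′ : n ∣ sum (setSite σ (x , y) v)
    balanced′ = ∣-transfer (balanced vv) (sum-set₂ (inject₁≢suc σ) v x y) congruent

  s-preserves : ∀ {v} σ → Vertex v → Vertex (s n m σ v)
  s-preserves {v} σ vv = subst Vertex (sym (s-local σ v))
    (setSite-preserves σ vv (move-admissible (siteOf σ) adm) (move-congruent (siteOf σ) adm))
    where adm = vertex⇒admissible vv σ

  s-setSite : ∀ σ v xy → s n m σ (setSite σ xy v) ≡ setSite σ (move n (siteOf σ) xy) v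
  s-setSite σ v xy = begin
    s n m σ w                                       ≡⟨ s-local σ w ⟩
    setSite σ (move n (siteOf σ) (pairAt σ w)) w    ≡⟨ cong (λ xy′ → setSite σ (move n (siteOf σ) xy′) w)
                                                            (pairAt-setSite σ v xy) ⟩
    setSite σ (move n (siteOf σ) xy) w              ≡⟨ set₂-idempotent (inject₁≢suc σ) v _ xy ⟩
    setSite σ (move n (siteOf σ) xy) v              ∎
    where open ≡-Reasoning
          w = setSite σ xy v

  s-involutive : ∀ {v} σ → Vertex v → s n m σ (s n m σ v) ≡ v
  s-involutive {v} σ vv = begin
    s n m σ (s n m σ v)                         ≡⟨ cong (s n m σ) (s-local σ v) ⟩
    s n m σ (setSite σ (move n κ (pairAt σ v)) v)  ≡⟨ s-setSite σ v _ ⟩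
    setSite σ (move n κ (move n κ (pairAt σ v))) v ≡⟨ cong (λ xy → setSite σ xy v)
                                                          (move-involutive κ (vertex⇒admissible vv σ)) ⟩
    setSite σ (pairAt σ v) v                    ≡⟨ set₂-lookup (inject₁ σ) (F.suc σ) v ⟩
    v                                           ∎
    where open ≡-Reasoning
          κ = siteOf σ

  record Apart (σ τ : Fin (suc m)) : Set where
    field
      inj-inj : inject₁ σ ≢ inject₁ τ
      inj-suc : inject₁ σ ≢ F.suc τ
      suc-inj : F.suc σ ≢ inject₁ τ
      suc-suc : F.suc σ ≢ F.suc τ

  apart-sym : ∀ {σ τ} → Apart σ τ → Apart τ σ
  apart-sym record { inj-inj = ii ; inj-suc = is ; suc-inj = si ; suc-suc = ss } =
    record { inj-inj = ii ∘ sym ; inj-suc = si ∘ sym ; suc-inj = is ∘ sym ; suc-suc = ss ∘ sym }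

  far⇒apart : ∀ {σ τ : Fin (suc m)} → suc (toℕ σ) < toℕ τ → Apart σ τ
  far⇒apart {σ} {τ} σ+1<τ = record
    { inj-inj = by-toℕ λ e → <⇒≢ σ<τ (trans (sym (toℕ-inject₁ σ)) (trans e (toℕ-inject₁ τ)))
    ; inj-suc = by-toℕ λ e → <⇒≢ (<-trans σ<τ (n<1+n _)) (trans (sym (toℕ-inject₁ σ)) e)
    ; suc-inj = by-toℕ λ e → <⇒≢ σ+1<τ (trans e (toℕ-inject₁ τ))
    ; suc-suc = by-toℕ λ e → <⇒≢ (<-trans σ+1<τ (n<1+n _)) e
    }
    where
    σ<τ : toℕ σ < toℕ τ
    σ<τ = <-trans (n<1+n _) σ+1<τ
    by-toℕ : ∀ {a b : Fin (suc (suc m))} → toℕ a ≢ toℕ b → a ≢ b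
    by-toℕ toℕ≢ a≡b = toℕ≢ (cong toℕ a≡b)

  pairAt-s-apart : ∀ {σ τ} → Apart σ τ → ∀ v → pairAt σ (s n m τ v) ≡ pairAt σ v
  pairAt-s-apart {σ} {τ} apart v = trans (cong (pairAt σ) (s-local τ v))
    (cong₂ _,_ (lookup-set₂-other inj-inj inj-suc v _) (lookup-set₂-other suc-inj suc-suc v _))
    where open Apart apart

  s-commute : ∀ {σ τ} → Apart σ τ → ∀ v → s n m σ (s n m τ v) ≡ s n m τ (s n m σ v)
  s-commute {σ} {τ} apart v = begin
    s n m σ (s n m τ v)
      ≡⟨ s-local σ _ ⟩
    setSite σ (move n κ (pairAt σ (s n m τ v))) (s n m τ v)
      ≡⟨ cong₂ (λ xy w → setSite σ (move n κ xy) w) (pairAt-s-apart apart v) (s-local τ v) ⟩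
    setSite σ (move n κ (pairAt σ v)) (setSite τ (move n κ′ (pairAt τ v)) v)
      ≡⟨ set₂-commutes inj-inj inj-suc suc-inj suc-suc v _ _ ⟩
    setSite τ (move n κ′ (pairAt τ v)) (setSite σ (move n κ (pairAt σ v)) v)
      ≡⟨ cong₂ (λ xy w → setSite τ (move n κ′ xy) w) (pairAt-s-apart (apart-sym apart) v) (s-local σ v) ⟨
    setSite τ (move n κ′ (pairAt τ (s n m σ v))) (s n m σ v)
      ≡⟨ s-local τ _ ⟨
    s n m τ (s n m σ v)
      ∎
    where
    open ≡-Reasoning
    open Apart apart
    κ = siteOf σ
    κ′ = siteOf τ

  -- Alternating words in σ and τ = σ + 1 only touch the coordinates σ, σ+1, σ+2, on which each
  -- letter pair acts by `round`.
  module Braid (σ τ : Fin (suc m)) (adjacent : F.suc σ ≡ inject₁ τ) where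

    private
      a = inject₁ σ
      b = F.suc σ
      c = F.suc τ
      a≢b : a ≢ b
      a≢b = inject₁≢suc σ
      b≢c : b ≢ c
      b≢c = subst (_≢ c) (sym adjacent) (inject₁≢suc τ)
      a≢c : a ≢ c
      a≢c a≡c = <⇒≢ (<-trans (n<1+n _) (n<1+n _)) (begin
        toℕ σ                  ≡⟨ toℕ-inject₁ σ ⟨
        toℕ a                  ≡⟨ cong toℕ a≡c ⟩
        suc (toℕ τ)            ≡⟨ cong suc (toℕ-inject₁ τ) ⟨
        suc (toℕ (inject₁ τ))  ≡⟨ cong (suc ∘ toℕ) adjacent ⟨
        suc (suc (toℕ σ))      ∎)
        where open ≡-Reasoning

    round : ℕ × ℕ × ℕ → ℕ × ℕ × ℕ
    round = moveˡ n (siteOf σ) ∘ moveʳ n (siteOf τ)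

    window-left : ∀ t v → s n m σ (set₃ a b c t v) ≡ set₃ a b c (moveˡ n (siteOf σ) t) v
    window-left (x , y , z) v = begin
      s n m σ w                                     ≡⟨ s-local σ w ⟩
      setSite σ (move n (siteOf σ) (pairAt σ w)) w  ≡⟨ cong (λ xy → setSite σ (move n (siteOf σ) xy) w)
                                                          (lookup-set₃ˡ a≢b a≢c b≢c v x y z) ⟩
      setSite σ (move n (siteOf σ) (x , y)) w       ≡⟨ set₂-set₃ˡ a≢b a≢c b≢c v x y z _ _ ⟩
      set₃ a b c (moveˡ n (siteOf σ) (x , y , z)) v ∎
      where open ≡-Reasoning
            w = set₃ a b c (x , y , z) v

    window-right : ∀ t v → s n m τ (set₃ a b c t v) ≡ set₃ a b c (moveʳ n (siteOf τ) t) v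
    window-right t v =
      subst (λ b″ → s n m τ (set₃ a b″ c t v) ≡ set₃ a b″ c (moveʳ n (siteOf τ) t) v) (sym adjacent) (window t)
      where
      b′ = inject₁ τ
      a≢b′ : a ≢ b′
      a≢b′ = subst (a ≢_) adjacent a≢b
      window : ∀ t → s n m τ (set₃ a b′ c t v) ≡ set₃ a b′ c (moveʳ n (siteOf τ) t) v
      window (x , y , z) = begin
        s n m τ w                                     ≡⟨ s-local τ w ⟩
        setSite τ (move n (siteOf τ) (pairAt τ w)) w  ≡⟨ cong (λ yz → setSite τ (move n (siteOf τ) yz) w)
                                                            (lookup-set₃ʳ a≢b′ a≢c (inject₁≢suc τ) v x y z) ⟩
        setSite τ (move n (siteOf τ) (y , z)) w       ≡⟨ set₂-set₃ʳ a≢b′ a≢c (inject₁≢suc τ) v x y z _ _ ⟩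
        set₃ a b′ c (moveʳ n (siteOf τ) (x , y , z)) v ∎
        where open ≡-Reasoning
              w = set₃ a b′ c (x , y , z) v

    window : ∀ k t v → act n m (alternate k σ τ) (set₃ a b c t v) ≡ set₃ a b c (fold t round k) v
    window zero    t v = refl
    window (suc k) t v = begin
      s n m σ (s n m τ (act n m (alternate k σ τ) (set₃ a b c t v)))
        ≡⟨ cong (s n m σ ∘ s n m τ) (window k t v) ⟩
      s n m σ (s n m τ (set₃ a b c (fold t round k) v))
        ≡⟨ cong (s n m σ) (window-right _ v) ⟩
      s n m σ (set₃ a b c (moveʳ n (siteOf τ) (fold t round k)) v)
        ≡⟨ window-left _ v ⟩
      set₃ a b c (fold t round (suc k)) v
        ∎
      where open ≡-Reasoning

    braid : ∀ k v → let t = lookup v a , lookup v b , lookup v c in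
            fold t round k ≡ t → act n m (alternate k σ τ) v ≡ v
    braid k v cycle = begin
      act n m (alternate k σ τ) v                 ≡⟨ cong (act n m (alternate k σ τ)) (set₃-lookup a≢b a≢c b≢c v) ⟨
      act n m (alternate k σ τ) (set₃ a b c t v)  ≡⟨ window k t v ⟩
      set₃ a b c (fold t round k) v               ≡⟨ cong (λ t′ → set₃ a b c t′ v) cycle ⟩
      set₃ a b c t v                              ≡⟨ set₃-lookup a≢b a≢c b≢c v ⟩
      v                                           ∎
      where open ≡-Reasoning
            t = lookup v a , lookup v b , lookup v c

  braid-relation : ∀ {σ τ κ κ′} k v → toℕ τ ≡ suc (toℕ σ) → siteOf σ ≡ κ → siteOf τ ≡ κ′ →
                   let t = lookup v (inject₁ σ) , lookup v (F.suc σ) , lookup v (F.suc τ) in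
                   fold t (moveˡ n κ ∘ moveʳ n κ′) k ≡ t → act n m (alternate k σ τ) v ≡ v
  braid-relation {σ} {τ} k v τ≡σ+1 refl refl =
    Braid.braid σ τ (toℕ-injective (trans (sym τ≡σ+1) (sym (toℕ-inject₁ τ)))) k v

  far-relation : ∀ {v} i j → suc (toℕ i) < toℕ j ⊎ suc (toℕ j) < toℕ i → Vertex v →
                 act n m (i ∷ j ∷ i ∷ j ∷ []) v ≡ v
  far-relation {v} i j far vv = begin
    s n m i (s n m j (s n m i (s n m j v)))  ≡⟨ cong (s n m i) (s-commute apart (s n m j v)) ⟩
    s n m i (s n m i (s n m j (s n m j v)))  ≡⟨ s-involutive i (s-preserves j (s-preserves j vv)) ⟩
    s n m j (s n m j v)                      ≡⟨ s-involutive j vv ⟩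
    v                                        ∎
    where
    open ≡-Reasoning
    apart : Apart j i
    apart = [ apart-sym ∘ far⇒apart , far⇒apart ]′ far

  coxeterAction : CoxeterAction n m
  coxeterAction = record
    { preserves = λ i v iv → vertex⇒isVertex (s-preserves i (isVertex⇒vertex iv))
    ; rel-sq    = λ i v iv → s-involutive i (isVertex⇒vertex iv)
    ; rel-far   = λ i j far v iv → far-relation i j far (isVertex⇒vertex iv)
    ; rel-mid   = mid-relation
    ; rel-left  = left-relation
    ; rel-right = right-relation
    }
    where
    mid-relation : ∀ i j → toℕ j ≡ suc (toℕ i) → 1 ≤ toℕ i → toℕ i ≤ m ∸ 2 → ∀ v → IsVertex n m v →
                   act n m (alternate 3 i j) v ≡ v
    mid-relation i j j≡i+1 1≤i i≤m-2 v _ =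
      braid-relation 3 v j≡i+1 (siteOf-inner 1≤i (s≤s (m≤n⇒m≤1+n i≤m-2)))
        (siteOf-inner (subst (1 ≤_) (sym j≡i+1) (s≤s z≤n)) (subst (_< m) (sym j≡i+1) (s≤s (s≤s i≤m-2))))
        (round-inner-inner³ _ _ _)

    left-relation : ∀ i j → toℕ i ≡ 0 → toℕ j ≡ 1 → ∀ v → IsVertex n m v → act n m (alternate 4 i j) v ≡ v
    left-relation F.zero (F.suc F.zero) refl refl v iv = braid-relation 4 v refl refl refl
      (round-left-inner⁴ (bounded vv F.zero) (bounded vv (F.suc F.zero)) (bounded vv (F.suc (F.suc F.zero))))
      where vv = isVertex⇒vertex iv

    right-relation : ∀ i j → toℕ i ≡ m ∸ 1 → toℕ j ≡ m → ∀ v → IsVertex n m v →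
                     act n m (alternate 4 i j) v ≡ v
    right-relation i j i≡m-1 j≡m v iv =
      braid-relation 4 v (trans j≡m (cong suc (sym i≡m-1))) i-inner (siteOf-last j≡m)
        (round-inner-right⁴ (proj₁ i-bits) (proj₂ i-bits) (proj₂ j-bits))
      where
      vv = isVertex⇒vertex iv
      i-inner : siteOf i ≡ inner
      i-inner = siteOf-inner (subst (1 ≤_) (sym i≡m-1) (s≤s z≤n)) (subst (_< m) (sym i≡m-1) ≤-refl)
      i-bits = subst (λ κ → Admissible n (ends κ) (pairAt i v)) i-inner (vertex⇒admissible vv i)
      j-bits = subst (λ κ → Admissible n (ends κ) (pairAt j v)) (siteOf-last j≡m) (vertex⇒admissible vv j)

  origin : Tuple m
  origin = replicate _ 0

  weight-s : ∀ σ v → weight (s n m σ v) + moment (toℕ σ) (pairAt σ v)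
                   ≡ weight v + moment (toℕ σ) (move n (siteOf σ) (pairAt σ v))
  weight-s σ v = begin
    weight (s n m σ v) + moment p (x , y)
      ≡⟨ cong₂ (λ w q → weight w + (q * x + suc p * y)) (s-local σ v) (sym (toℕ-inject₁ σ)) ⟩
    weight (setSite σ M v) + (toℕ (inject₁ σ) * x + toℕ (F.suc σ) * y)
      ≡⟨ weight-set₂ (inject₁≢suc σ) v _ _ ⟩
    weight v + (toℕ (inject₁ σ) * proj₁ M + toℕ (F.suc σ) * proj₂ M)
      ≡⟨ cong (λ q → weight v + (q * proj₁ M + suc p * proj₂ M)) (toℕ-inject₁ σ) ⟩
    weight v + moment p M
      ∎
    where
    open ≡-Reasoning
    p = toℕ σ
    x = lookup v (inject₁ σ)
    y = lookup v (F.suc σ)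
    M = move n (siteOf σ) (x , y)

  s-lowers-weight : ∀ σ v → let p = toℕ σ ; xy = pairAt σ v in
                    moment p xy ≡ suc (moment p (move n (siteOf σ) xy)) → suc (weight (s n m σ v)) ≡ weight v
  s-lowers-weight σ v lowers = +-cancelʳ-≡ (moment p M) _ _ (begin
    suc (weight (s n m σ v)) + moment p M        ≡⟨ +-suc (weight (s n m σ v)) (moment p M) ⟨
    weight (s n m σ v) + suc (moment p M)        ≡⟨ cong (weight (s n m σ v) +_) lowers ⟨
    weight (s n m σ v) + moment p (pairAt σ v)   ≡⟨ weight-s σ v ⟩
    weight v + moment p M                        ∎)
    where
    open ≡-Reasoning
    p = toℕ σ
    M = move n (siteOf σ) (pairAt σ v)

  -- Unless v = 0, move the first nonzero coordinate after v₀ one step to the left.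
  descent : ∀ {v} → Vertex v → v ≡ origin ⊎ ∃ λ σ → suc (weight (s n m σ v)) ≡ weight v
  descent {x ∷ t} vv with vanishes⊎rises t
  ... | inj₁ zeros = inj₁ (cong₂ _∷_ x≡0 t≡0)
    where
    t≡0 : t ≡ replicate _ 0
    t≡0 = lookup-extensionality λ j → trans (zeros j) (sym (lookup-replicate j 0))
    sum≡x : sum (x ∷ t) ≡ x
    sum≡x = trans (cong (λ u → x + sum u) t≡0)
                  (trans (cong (x +_) (sum-replicate-zero (suc m))) (+-identityʳ x))
    x≡0 : x ≡ 0
    x≡0 = trans (sym (m<n⇒m%n≡m (bounded vv F.zero))) (n∣m⇒m%n≡0 x n (subst (n ∣_) sum≡x (balanced vv)))
  ... | inj₂ (inj₁ 1≤t₀) =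
    inj₂ (F.zero , s-lowers-weight F.zero (x ∷ t) (move-left-lowers-moment (bounded vv (F.suc F.zero)) 1≤t₀))
  ... | inj₂ (inj₂ (j , tⱼ≡0 , 1≤tⱼ₊₁)) = inj₂ (σ , s-lowers-weight σ (x ∷ t) lowers)
    where
    σ = F.suc j
    κ = siteOf σ
    y = lookup t (F.suc j)
    not-left : ∀ b → siteFor false b ≢ left
    not-left true  ()
    not-left false ()
    adm : Admissible n (ends κ) (0 , y)
    adm = subst (λ x′ → Admissible n (ends κ) (x′ , y)) tⱼ≡0 (vertex⇒admissible vv σ)
    lowers : moment (toℕ σ) (pairAt σ (x ∷ t)) ≡ suc (moment (toℕ σ) (move n κ (pairAt σ (x ∷ t))))
    lowers = subst (λ x′ → moment (toℕ σ) (x′ , y) ≡ suc (moment (toℕ σ) (move n κ (x′ , y)))) (sym tⱼ≡0)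
                   (move-lowers-moment κ (not-left _) adm 1≤tⱼ₊₁ (toℕ σ))

  act-++ : ∀ w₁ w₂ v → act n m (w₁ ++ w₂) v ≡ act n m w₁ (act n m w₂ v)
  act-++ []       w₂ v = refl
  act-++ (σ ∷ w₁) w₂ v = cong (s n m σ) (act-++ w₁ w₂ v)

  act-preserves : ∀ {v} w → Vertex v → Vertex (act n m w v)
  act-preserves []      vv = vv
  act-preserves (σ ∷ w) vv = s-preserves σ (act-preserves w vv)

  act-reverse : ∀ {v} w → Vertex v → act n m (reverse w) (act n m w v) ≡ v
  act-reverse     []      vv = refl
  act-reverse {v} (σ ∷ w) vv = begin
    act n m (reverse (σ ∷ w)) (s n m σ u)      ≡⟨ cong (λ w′ → act n m w′ (s n m σ u)) (unfold-reverse σ w) ⟩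
    act n m (reverse w ++ σ ∷ []) (s n m σ u)  ≡⟨ act-++ (reverse w) (σ ∷ []) (s n m σ u) ⟩
    act n m (reverse w) (s n m σ (s n m σ u))  ≡⟨ cong (act n m (reverse w)) (s-involutive σ (act-preserves w vv)) ⟩
    act n m (reverse w) u                      ≡⟨ act-reverse w vv ⟩
    v                                          ∎
    where open ≡-Reasoning
          u = act n m w v

  reach-origin : ∀ {v} → Acc _<_ (weight v) → Vertex v → ∃ λ w → act n m w v ≡ origin
  reach-origin {v} (acc smaller) vv with descent vv
  ... | inj₁ v≡origin = [] , v≡origin
  ... | inj₂ (σ , lowered) with reach-origin (smaller (≤-reflexive lowered)) (s-preserves σ vv)
  ...   | w , reached = w ++ σ ∷ [] , trans (act-++ w (σ ∷ []) v) reached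

  transitiveAction : TransitiveAction n m
  transitiveAction u v iu iv = reverse wᵤ ++ wᵥ , (begin
    act n m (reverse wᵤ ++ wᵥ) v         ≡⟨ act-++ (reverse wᵤ) wᵥ v ⟩
    act n m (reverse wᵤ) (act n m wᵥ v)  ≡⟨ cong (act n m (reverse wᵤ)) (trans v↦origin (sym u↦origin)) ⟩
    act n m (reverse wᵤ) (act n m wᵤ u)  ≡⟨ act-reverse wᵤ uu ⟩
    u                                    ∎)
    where
    open ≡-Reasoning
    uu = isVertex⇒vertex iu
    vv = isVertex⇒vertex iv
    reach : ∀ {x} → Vertex x → ∃ λ w → act n m w x ≡ origin
    reach = reach-origin (<-wellFounded _)
    wᵤ = proj₁ (reach uu)
    u↦origin = proj₂ (reach uu)
    wᵥ = proj₁ (reach vv)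
    v↦origin = proj₂ (reach vv)

  adjacent⇒s : ∀ {u v} → Vertex u → Vertex v → Adjacent n m u v → ∃ λ σ → u ≡ s n m σ v
  adjacent⇒s {u} {v} uu vv (σ , agree , step) = σ , (begin
    u                                             ≡⟨ agree-off⇒≡set₂ (inject₁≢suc σ) agree ⟩
    setSite σ (pairAt σ u) v                      ≡⟨ cong (λ xy → setSite σ xy v) moved ⟩
    setSite σ (move n (siteOf σ) (pairAt σ v)) v  ≡⟨ s-local σ v ⟨
    s n m σ v                                     ∎)
    where
    open ≡-Reasoning
    moved : pairAt σ u ≡ move n (siteOf σ) (pairAt σ v)
    moved = step⇒move (siteOf σ) (vertex⇒admissible vv σ) (vertex⇒admissible uu σ)
              (subst (λ f → Step n f (pairAt σ v) (pairAt σ u)) (bucketFlags-siteOf σ) step)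

  s⇒adjacent : ∀ {v} σ → Vertex v → s n m σ v ≢ v → Adjacent n m (s n m σ v) v
  s⇒adjacent {v} σ vv s≢id = σ , agree , step
    where
    κ = siteOf σ
    M = move n κ (pairAt σ v)
    agree : ∀ j → j ≢ inject₁ σ → j ≢ F.suc σ → lookup (s n m σ v) j ≡ lookup v j
    agree j j≢a j≢b = trans (cong (λ w → lookup w j) (s-local σ v)) (lookup-set₂-other j≢a j≢b v M)
    pairAt-s : pairAt σ (s n m σ v) ≡ M
    pairAt-s = trans (cong (pairAt σ) (s-local σ v)) (pairAt-setSite σ v M)
    moves : M ≢ pairAt σ v
    moves M≡ = s≢id (trans (s-local σ v)
                           (trans (cong (λ xy → setSite σ xy v) M≡) (set₂-lookup (inject₁ σ) (F.suc σ) v)))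
    step : Step n (bucketFlags σ) (pairAt σ v) (pairAt σ (s n m σ v))
    step = subst₂ (λ f xy → Step n f (pairAt σ v) xy) (sym (bucketFlags-siteOf σ)) (sym pairAt-s)
                  (move⇒step κ (vertex⇒admissible vv σ) moves)

  schreierAdjacency : SchreierAdjacency n m
  schreierAdjacency u v iu iv u≢v = mk⇔
    (adjacent⇒s (isVertex⇒vertex iu) (isVertex⇒vertex iv))
    (λ (σ , u≡sv) → subst (λ w → Adjacent n m w v) (sym u≡sv)
                          (s⇒adjacent σ (isVertex⇒vertex iv) (u≢v ∘ trans u≡sv)))

corollary3p17 : (n m : ℕ) .{{_ : NonZero n}} → 2 ≤ m →
    CoxeterAction n m × TransitiveAction n m × SchreierAdjacency n m
corollary3p17 n (suc (suc m′)) (s≤s (s≤s z≤n)) =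
  Yoke.coxeterAction n m′ , Yoke.transitiveAction n m′ , Yoke.schreierAdjacency n m′
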